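{- Let $d\geq 2$ be an integer and let $r=\operatorname{ord}_2(d)$ be the $2$-adic valuation of $d$, and suppose $r\geq 2$. Suppose integers $x,y$ and an integer $n\geq 2$ satisfy \[ d\left(\left(x+\frac{d+1}{2}\right)^2+\frac{(d-1)(d+1)}{12}\right)=y^n, \] (equivalently, $(x+1)^2+(x+2)^2+\cdots+(x+d)^2=y^n$). Then $n$ divides $r-1$. -}

module Defs where

open import Data.Nat using (ℕ; suc; _^_)
open import Data.Nat.Divisibility using (_∣_)
open import Data.Product using (_×_)
open import Relation.Nullary using (¬_)

IsOrd2 : ℕ → ℕ → Set
IsOrd2 r d = (2 ^ r ∣ d) × ¬ (2 ^ suc r ∣ d)

-- Write d = 2^r q with q odd and put m = 2^(r−2) q, so d = 4m. Clearing denominators turns the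
-- equation into d (3 (2x + d + 1)² + d² − 1) = 12 yⁿ, and since 2x + d + 1 is odd the bracket is
-- 2 mod 4; hence 2^(r−1) · (odd) = 3 yⁿ. Comparing 2-adic valuations gives r − 1 = n · ν₂(y).
module Submission where

open import Defs
open import Data.Nat using (ℕ; _≤_; _∸_)
open import Data.Nat.Divisibility using (_∣_)
open import Data.Integer using (ℤ; +_; ∣_∣)
open import Data.Integer as ℤ using ()
open import Relation.Binary.PropositionalEquality using (_≡_)

open import Data.Nat using (zero; suc; _<_; z<s; s≤s)
import Data.Nat as ℕ
open import Data.Nat.Divisibility using (divides)
open import Data.Product using (∃-syntax; _×_; _,_; proj₁; proj₂)
open import Data.Sum using (_⊎_; inj₁; inj₂)
open import Relation.Nullary using (contradiction)
open import Relation.Binary.PropositionalEquality using (_≢_; refl; sym; trans; cong; module ≡-Reasoning)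

module TwoAdic where
  open import Data.Nat using (_+_; _*_; _^_; ≢-nonZero⁻¹)
  open import Data.Nat.Properties
    using (*-suc; *-identityˡ; *-assoc; *-comm; *-zeroʳ; *-cancelˡ-≡; even≢odd; m<m+n; m*n≢0; m^n≢0; ^-*-assoc; *-commutativeSemigroup)
  open import Data.Nat.Induction using (<-rec)
  open import Data.Nat.Tactic.RingSolver using (solve-∀)
  open import Algebra.Properties.CommutativeSemigroup *-commutativeSemigroup using (interchange; x∙yz≈y∙xz)

  Odd : ℕ → Set
  Odd m = ∃[ j ] m ≡ suc (2 * j)

  even⊎odd : ∀ n → (∃[ k ] n ≡ 2 * k) ⊎ Odd n
  even⊎odd zero = inj₁ (0 , refl)
  even⊎odd (suc n) with even⊎odd n
  ... | inj₁ (k , refl) = inj₂ (k , refl)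
  ... | inj₂ (k , refl) = inj₁ (suc k , sym (*-suc 2 k))

  odd-* : ∀ {m n} → Odd m → Odd n → Odd (m * n)
  odd-* (i , refl) (j , refl) = i + j + 2 * i * j , odd*odd i j
    where
    odd*odd : ∀ i j → suc (2 * i) * suc (2 * j) ≡ suc (2 * (i + j + 2 * i * j))
    odd*odd = solve-∀

  odd-^ : ∀ {m} n → Odd m → Odd (m ^ n)
  odd-^ zero    _     = 0 , refl
  odd-^ (suc n) odd-m = odd-* odd-m (odd-^ n odd-m)

  ^-distrib-* : ∀ a b n → (a * b) ^ n ≡ a ^ n * b ^ n
  ^-distrib-* a b zero    = refl
  ^-distrib-* a b (suc n) = trans (cong (a * b *_) (^-distrib-* a b n)) (interchange a b (a ^ n) (b ^ n))

  2^*odd-injective : ∀ a b {o o′} → Odd o → Odd o′ → 2 ^ a * o ≡ 2 ^ b * o′ → a ≡ b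
  2^*odd-injective zero    zero    _ _ _ = refl
  2^*odd-injective zero    (suc b) {o′ = o′} (j , refl) _ e =
    contradiction (trans (sym (*-assoc 2 (2 ^ b) o′)) (trans (sym e) (*-identityˡ _))) (even≢odd (2 ^ b * o′) j)
  2^*odd-injective (suc a) zero    {o} _ (j , refl) e =
    contradiction (trans (sym (*-assoc 2 (2 ^ a) o)) (trans e (*-identityˡ _))) (even≢odd (2 ^ a * o) j)
  2^*odd-injective (suc a) (suc b) {o} {o′} odd-o odd-o′ e =
    cong suc (2^*odd-injective a b odd-o odd-o′
      (*-cancelˡ-≡ _ _ 2 (trans (sym (*-assoc 2 (2 ^ a) o)) (trans e (*-assoc 2 (2 ^ b) o′)))))

  2^*odd≢0 : ∀ a {o} → Odd o → 2 ^ a * o ≢ 0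
  2^*odd≢0 a (j , refl) = ≢-nonZero⁻¹ _ {{m*n≢0 (2 ^ a) _ {{m^n≢0 2 a}}}}

  2-adic-decomposition : ∀ z → z ≢ 0 → ∃[ s ] ∃[ o ] Odd o × z ≡ 2 ^ s * o
  2-adic-decomposition = <-rec _ split
    where
    split : ∀ z → (∀ {w} → w < z → w ≢ 0 → ∃[ s ] ∃[ o ] Odd o × w ≡ 2 ^ s * o) →
            z ≢ 0 → ∃[ s ] ∃[ o ] Odd o × z ≡ 2 ^ s * o
    split z rec z≢0 with even⊎odd z
    ... | inj₂ odd-z = 0 , z , odd-z , sym (*-identityˡ z)
    ... | inj₁ (zero , refl) = contradiction refl z≢0
    ... | inj₁ (suc v , refl) with rec (m<m+n (suc v) z<s) (λ ())
    ... | s , o , odd-o , eq = suc s , o , odd-o , trans (cong (2 *_) eq) (sym (*-assoc 2 (2 ^ s) o))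

  2^a*odd≡odd*zⁿ⇒n∣a : ∀ {a o o′} z n → Odd o → Odd o′ → 2 ^ a * o ≡ o′ * z ^ n → n ∣ a
  2^a*odd≡odd*zⁿ⇒n∣a zero zero    odd-o odd-o′ e = 2^a*odd≡odd*zⁿ⇒n∣a 1 zero odd-o odd-o′ e   -- 0 ^ 0 = 1 ^ 0
  2^a*odd≡odd*zⁿ⇒n∣a {a} {o′ = o′} zero (suc n) odd-o odd-o′ e = contradiction (trans e (*-zeroʳ o′)) (2^*odd≢0 a odd-o)
  2^a*odd≡odd*zⁿ⇒n∣a {a} {o} {o′} (suc z) n odd-o odd-o′ e with 2-adic-decomposition (suc z) (λ ())
  ... | s , p , odd-p , eq = divides s (2^*odd-injective a (s * n) odd-o (odd-* odd-o′ (odd-^ n odd-p)) e′)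
    where
    e′ : 2 ^ a * o ≡ 2 ^ (s * n) * (o′ * p ^ n)
    e′ = begin
      2 ^ a * o                   ≡⟨ e ⟩
      o′ * suc z ^ n              ≡⟨ cong (λ t → o′ * t ^ n) eq ⟩
      o′ * (2 ^ s * p) ^ n        ≡⟨ cong (o′ *_) (^-distrib-* (2 ^ s) p n) ⟩
      o′ * ((2 ^ s) ^ n * p ^ n)  ≡⟨ cong (λ t → o′ * (t * p ^ n)) (^-*-assoc 2 s n) ⟩
      o′ * (2 ^ (s * n) * p ^ n)  ≡⟨ x∙yz≈y∙xz o′ (2 ^ (s * n)) (p ^ n) ⟩
      2 ^ (s * n) * (o′ * p ^ n)  ∎
      where open ≡-Reasoning

  IsOrd2⇒odd-cofactor : ∀ r {d} → IsOrd2 r d → ∃[ q ] Odd q × d ≡ q * 2 ^ r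
  IsOrd2⇒odd-cofactor r (divides q d≡q*2^r , 2^1+r∤d) with even⊎odd q
  ... | inj₂ odd-q       = q , odd-q , d≡q*2^r
  ... | inj₁ (k , refl) =
    contradiction (divides k (trans d≡q*2^r (trans (cong (_* 2 ^ r) (*-comm 2 k)) (*-assoc k 2 (2 ^ r))))) 2^1+r∤d

open TwoAdic

module IntegerArithmetic where
  open import Data.Integer using (_+_; _*_; _-_; -_; _^_)
  open import Data.Integer.Properties using (abs-*; ∣-i∣≡∣i∣; pos-+; pos-*; *-cancelˡ-≡)
  open import Data.Integer.Tactic.RingSolver using (solve-∀)

  ∣i^n∣≡∣i∣^n : ∀ i n → ∣ i ^ n ∣ ≡ ∣ i ∣ ℕ.^ n
  ∣i^n∣≡∣i∣^n i zero    = refl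
  ∣i^n∣≡∣i∣^n i (suc n) = trans (abs-* i (i ^ n)) (cong (∣ i ∣ ℕ.*_) (∣i^n∣≡∣i∣^n i n))

  odd-∣1+2i∣ : ∀ i → Odd ∣ + 1 + + 2 * i ∣
  odd-∣1+2i∣ (+ k)      = k , cong ∣_∣ (trans (cong (_+_ (+ 1)) (sym (pos-* 2 k))) (sym (pos-+ 1 (2 ℕ.* k))))
  odd-∣1+2i∣ ℤ.-[1+ k ] = k , trans (cong ∣_∣ (reflect (+ k))) (trans (∣-i∣≡∣i∣ (+ 1 + + 2 * + k)) (odd-∣1+2i∣ (+ k) .proj₂))
    where
    reflect : ∀ j → + 1 + + 2 * - (+ 1 + j) ≡ - (+ 1 + + 2 * j)
    reflect = solve-∀

  +m*i≡+k*jⁿ⇒m*∣i∣≡k*∣j∣ⁿ : ∀ m i k j n → + m * i ≡ + k * j ^ n → m ℕ.* ∣ i ∣ ≡ k ℕ.* ∣ j ∣ ℕ.^ n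
  +m*i≡+k*jⁿ⇒m*∣i∣≡k*∣j∣ⁿ m i k j n eq =
    trans (sym (abs-* (+ m) i)) (trans (cong ∣_∣ eq) (trans (abs-* (+ k) (j ^ n)) (cong (k ℕ.*_) (∣i^n∣≡∣i∣^n j n))))

  -- For a = 4m the bracket 3 (2x + 4m + 1)² + 16m² − 1 is 2 mod 4, as odd squares are 1 mod 4.
  4∣a⇒half-a*odd≡3Y : ∀ {a b c} m x Y → a ≡ + (4 ℕ.* m) → b ≡ a - + 1 → c ≡ a + + 1 →
    a * (+ 3 * (+ 2 * x + c) * (+ 2 * x + c) + b * c) ≡ + 12 * Y →
    ∃[ w ] + (2 ℕ.* m) * (+ 1 + + 2 * w) ≡ + 3 * Y
  4∣a⇒half-a*odd≡3Y m x Y refl refl refl eq = w , *-cancelˡ-≡ (+ 4) _ _ (begin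
    + 4 * (+ (2 ℕ.* m) * (+ 1 + + 2 * w))  ≡⟨ cong (λ t → + 4 * (t * (+ 1 + + 2 * w))) (pos-* 2 m) ⟩
    + 4 * (+ 2 * + m * (+ 1 + + 2 * w))    ≡⟨ expand (+ m) x ⟩
    P (+ 4 * + m)                          ≡⟨ cong P (pos-* 4 m) ⟨
    P (+ (4 ℕ.* m))                        ≡⟨ eq ⟩
    + 12 * Y                               ≡⟨ twelve Y ⟩
    + 4 * (+ 3 * Y)                        ∎)
    where
    open ≡-Reasoning
    u w : ℤ
    u = x + + 2 * + m
    w = + 3 * u * u + + 3 * u + + 4 * (+ m * + m)
    P : ℤ → ℤ
    P a = a * (+ 3 * (+ 2 * x + (a + + 1)) * (+ 2 * x + (a + + 1)) + (a - + 1) * (a + + 1))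
    expand : ∀ m x → let u = x + + 2 * m in
      + 4 * (+ 2 * m * (+ 1 + + 2 * (+ 3 * u * u + + 3 * u + + 4 * (m * m)))) ≡
      + 4 * m * (+ 3 * (+ 2 * x + (+ 4 * m + + 1)) * (+ 2 * x + (+ 4 * m + + 1)) + (+ 4 * m - + 1) * (+ 4 * m + + 1))
    expand = solve-∀
    twelve : ∀ Y → + 12 * Y ≡ + 4 * (+ 3 * Y)
    twelve = solve-∀

open IntegerArithmetic

open import Data.Rational using (ℚ; _/_; _+_; _*_; toℚᵘ)
open import Data.Rational.Properties using (toℚᵘ-fromℚᵘ; toℚᵘ-cong; toℚᵘ-homo-+; toℚᵘ-homo-*)
open import Data.Rational.Unnormalised as ℚᵘ using (mkℚᵘ; *≡*) renaming (_≃_ to _≃ᵘ_)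
import Data.Rational.Unnormalised.Properties as ℚᵘ
import Data.Integer.Properties as ℤ
open import Data.Integer.Tactic.RingSolver using (solve-∀)
import Data.Nat.Tactic.RingSolver as NatSolver

toℚᵘ-/ : ∀ i k → toℚᵘ (i / suc k) ≃ᵘ mkℚᵘ i k
toℚᵘ-/ i k = toℚᵘ-fromℚᵘ (mkℚᵘ i k)

clear-denominators : ∀ a x c p Y →
  (a / 1) * ((x / 1 + c / 2) * (x / 1 + c / 2) + p / 12) ≡ Y / 1 →
  a ℤ.* (+ 3 ℤ.* (+ 2 ℤ.* x ℤ.+ c) ℤ.* (+ 2 ℤ.* x ℤ.+ c) ℤ.+ p) ≡ + 12 ℤ.* Y
clear-denominators a x c p Y eq = ℤ.*-cancelˡ-≡ (+ 4) _ _ (begin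
  + 4 ℤ.* (a ℤ.* (+ 3 ℤ.* (+ 2 ℤ.* x ℤ.+ c) ℤ.* (+ 2 ℤ.* x ℤ.+ c) ℤ.+ p))
    ≡⟨ scale a x c p ⟩
  a ℤ.* ((x ℤ.* + 2 ℤ.+ c ℤ.* + 1) ℤ.* (x ℤ.* + 2 ℤ.+ c ℤ.* + 1) ℤ.* + 12 ℤ.+ p ℤ.* + 4) ℤ.* + 1
    ≡⟨ cross-multiplied ⟩
  Y ℤ.* + 48
    ≡⟨ scale-rhs Y ⟩
  + 4 ℤ.* (+ 12 ℤ.* Y) ∎)
  where
  open ≡-Reasoning
  scale : ∀ a x c p → + 4 ℤ.* (a ℤ.* (+ 3 ℤ.* (+ 2 ℤ.* x ℤ.+ c) ℤ.* (+ 2 ℤ.* x ℤ.+ c) ℤ.+ p)) ≡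
    a ℤ.* ((x ℤ.* + 2 ℤ.+ c ℤ.* + 1) ℤ.* (x ℤ.* + 2 ℤ.+ c ℤ.* + 1) ℤ.* + 12 ℤ.+ p ℤ.* + 4) ℤ.* + 1
  scale = solve-∀
  scale-rhs : ∀ Y → Y ℤ.* + 48 ≡ + 4 ℤ.* (+ 12 ℤ.* Y)
  scale-rhs = solve-∀
  base : ℚ
  base = x / 1 + c / 2
  base≃ : toℚᵘ base ≃ᵘ mkℚᵘ x 0 ℚᵘ.+ mkℚᵘ c 1
  base≃ = ℚᵘ.≃-trans (toℚᵘ-homo-+ (x / 1) (c / 2)) (ℚᵘ.+-cong (toℚᵘ-/ x 0) (toℚᵘ-/ c 1))
  lhs≃ : toℚᵘ ((a / 1) * (base * base + p / 12)) ≃ᵘ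
         mkℚᵘ a 0 ℚᵘ.* ((mkℚᵘ x 0 ℚᵘ.+ mkℚᵘ c 1) ℚᵘ.* (mkℚᵘ x 0 ℚᵘ.+ mkℚᵘ c 1) ℚᵘ.+ mkℚᵘ p 11)
  lhs≃ = ℚᵘ.≃-trans (toℚᵘ-homo-* (a / 1) _) (ℚᵘ.*-cong (toℚᵘ-/ a 0)
           (ℚᵘ.≃-trans (toℚᵘ-homo-+ (base * base) (p / 12))
             (ℚᵘ.+-cong (ℚᵘ.≃-trans (toℚᵘ-homo-* base base) (ℚᵘ.*-cong base≃ base≃)) (toℚᵘ-/ p 11))))
  cross-multiplied :
    a ℤ.* ((x ℤ.* + 2 ℤ.+ c ℤ.* + 1) ℤ.* (x ℤ.* + 2 ℤ.+ c ℤ.* + 1) ℤ.* + 12 ℤ.+ p ℤ.* + 4) ℤ.* + 1 ≡ Y ℤ.* + 48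
  cross-multiplied with ℚᵘ.≃-trans (ℚᵘ.≃-sym lhs≃) (ℚᵘ.≃-trans (toℚᵘ-cong eq) (toℚᵘ-/ Y 0))
  ... | *≡* e = e

lemma2p2 : (d r : ℕ) → 2 ≤ d → IsOrd2 r d → 2 ≤ r →
           (x y : ℤ) (n : ℕ) → 2 ≤ n →
           (+ d / 1) * (((x / 1) + (+ (d Data.Nat.+ 1) / 2)) * ((x / 1) + (+ (d Data.Nat.+ 1) / 2))
                        + ((+ (d ∸ 1) ℤ.* + (d Data.Nat.+ 1)) / 12))
             ≡ (y ℤ.^ n) / 1 →
           n ∣ r ∸ 1
lemma2p2 (suc d′) (suc (suc r)) (s≤s _) ord2 (s≤s (s≤s _)) x y n _ eq
  with IsOrd2⇒odd-cofactor (suc (suc r)) ord2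
... | q , odd-q , d≡q*2^[2+r] =
  2^a*odd≡odd*zⁿ⇒n∣a ∣ y ∣ n (odd-* odd-q (odd-∣1+2i∣ w)) (1 , refl)
    (trans (regroup q (2 ℕ.^ r) _) (+m*i≡+k*jⁿ⇒m*∣i∣≡k*∣j∣ⁿ (2 ℕ.* m) _ 3 y n 2m*odd≡3yⁿ))
  where
  m : ℕ
  m = q ℕ.* 2 ℕ.^ r
  pull-out-4 : ∀ q P → q ℕ.* (2 ℕ.* (2 ℕ.* P)) ≡ 4 ℕ.* (q ℕ.* P)
  pull-out-4 = NatSolver.solve-∀
  regroup : ∀ q P o → 2 ℕ.* P ℕ.* (q ℕ.* o) ≡ 2 ℕ.* (q ℕ.* P) ℕ.* o
  regroup = NatSolver.solve-∀
  cleared : + suc d′ ℤ.* (+ 3 ℤ.* (+ 2 ℤ.* x ℤ.+ + (suc d′ ℕ.+ 1)) ℤ.* (+ 2 ℤ.* x ℤ.+ + (suc d′ ℕ.+ 1))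
                          ℤ.+ + d′ ℤ.* + (suc d′ ℕ.+ 1))
            ≡ + 12 ℤ.* (y ℤ.^ n)
  cleared = clear-denominators (+ suc d′) x (+ (suc d′ ℕ.+ 1)) (+ d′ ℤ.* + (suc d′ ℕ.+ 1)) (y ℤ.^ n) eq
  halved : ∃[ w ] + (2 ℕ.* m) ℤ.* (+ 1 ℤ.+ + 2 ℤ.* w) ≡ + 3 ℤ.* y ℤ.^ n
  halved = 4∣a⇒half-a*odd≡3Y m x (y ℤ.^ n) (cong +_ (trans d≡q*2^[2+r] (pull-out-4 q (2 ℕ.^ r)))) refl refl cleared
  w : ℤ
  w = proj₁ halved
  2m*odd≡3yⁿ : + (2 ℕ.* m) ℤ.* (+ 1 ℤ.+ + 2 ℤ.* w) ≡ + 3 ℤ.* y ℤ.^ n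
  2m*odd≡3yⁿ = proj₂ halved
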